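{- For every $n\ge 1$ there is a bijection $\phi^{(D)}_V:\mathcal{VS}^{(D)}_n\to\mathcal{T}^*_n$ which, for each $1\le k\le n$, restricts to a bijection from $\mathcal{VS}^{(D)}_{n,k}$ onto $\mathcal{T}^*_{n,k}$.
   Context: Signed permutations in window notation $\sigma=\sigma_1\cdots\sigma_n$ (entries in $\{\pm1,\dots,\pm n\}$, absolute values a permutation of $[n]$), $\bar a=-a$, $|\sigma|=|\sigma_1|\cdots|\sigma_n|$. Position $i$ of a sequence $w$ of distinct positive integers is a valley if $2\le i\le n-1$ and $w_{i-1}>w_i<w_{i+1}$, or $i=1$ and $w_1<w_2$. $\mathcal{VS}^{(D)}_n$: signed permutations with $\sigma_1<0$, $|\sigma_1|>\sigma_2>0$ (when $n\ge2$), and such that for $i\ge 3$, $\sigma_i<0$ implies $|\sigma_{i-1}|$ is a valley of $|\sigma|$; $\mathcal{VS}^{(D)}_{n,k}$: those with $\sigma_1=\bar k$. $\mathcal{T}_n$: complete increasing binary trees with $n$ labelled nodes — plane rooted trees in which every node is a leaf or has two ordered children (left, right), exactly $n$ nodes labelled bijectively by $[n]$, all non-leaf nodes labelled (leaves may be labelled or empty), labels increasing along paths from the root. Rightmost path $(v_1,\dots,v_d)$: $v_1$ the root, $v_{i+1}$ the right child of $v_i$, $v_d$ a leaf. $\mathcal{T}^*_n$: trees with $v_d$ labelled; the rightmost label of such a tree is the label of $v_d$. $\mathcal{T}^*_{n,k}$: those with rightmost label $k$. -}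

module Defs where

open import Data.Nat as ℕ using (ℕ; zero; suc; _∸_)
open import Data.Integer as ℤ using (ℤ; +_; -_; ∣_∣)
open import Data.List using (List; []; _∷_; map; length; upTo; _++_)
open import Data.List.Relation.Binary.Permutation.Propositional using (_↭_)
open import Data.Maybe using (Maybe; just; nothing)
open import Data.Product using (_×_; Σ; ∃)
open import Data.Sum using (_⊎_)
open import Data.Unit using (⊤)
open import Relation.Binary.PropositionalEquality using (_≡_)
open import Function.Bundles using (_⇔_)

range : ℕ → List ℕ
range n = map suc (upTo n)

-- 1-indexed entry of a list (default value d outside 1..length; only used in range)
entry : {A : Set} → A → List A → ℕ → A
entry d []       _             = d
entry d (x ∷ xs) zero          = d
entry d (x ∷ xs) (suc zero)    = x
entry d (x ∷ xs) (suc (suc i)) = entry d xs (suc i)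

-- Signed permutations in window notation: list of integers of length n
-- whose absolute values form a permutation of [n].

SignedPerm : ℕ → List ℤ → Set
SignedPerm n σ = length σ ≡ n × map ∣_∣ σ ↭ range n

σ[_] : List ℤ → ℕ → ℤ
σ[ σ ] i = entry (+ 0) σ i

IsValley : (n : ℕ) → List ℕ → ℕ → Set
IsValley n w i =
    (i ≡ 1 × w ! 1 ℕ.< w ! 2)
  ⊎ (2 ℕ.≤ i × i ℕ.≤ n ∸ 1 × w ! i ℕ.< w ! (i ∸ 1) × w ! i ℕ.< w ! suc i)
  where
  _!_ : List ℕ → ℕ → ℕ
  v ! j = entry 0 v j

VSD : ℕ → List ℤ → Set
VSD n σ =
    SignedPerm n σ
  × σ[ σ ] 1 ℤ.< + 0
  × (2 ℕ.≤ n → (+ 0 ℤ.< σ[ σ ] 2 × σ[ σ ] 2 ℤ.< + ∣ σ[ σ ] 1 ∣))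
  × (∀ i → 3 ℕ.≤ i → i ℕ.≤ n → σ[ σ ] i ℤ.< + 0 → IsValley n (map ∣_∣ σ) (i ∸ 1))

VSDk : ℕ → ℕ → List ℤ → Set
VSDk n k σ = VSD n σ × σ[ σ ] 1 ≡ - (+ k)

-- Complete binary trees: a leaf is labelled (just a) or empty (nothing);
-- internal nodes are labelled and have ordered left/right children.

data Tree : Set where
  leaf : Maybe ℕ → Tree
  node : ℕ → Tree → Tree → Tree

labels : Tree → List ℕ
labels (leaf nothing)  = []
labels (leaf (just a)) = a ∷ []
labels (node a l r)    = labels l ++ (a ∷ labels r)

Above : ℕ → Tree → Set
Above a (leaf nothing)  = ⊤
Above a (leaf (just b)) = a ℕ.< b
Above a (node b _ _)    = a ℕ.< b

Increasing : Tree → Set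
Increasing (leaf _)     = ⊤
Increasing (node a l r) = Above a l × Above a r × Increasing l × Increasing r

IsT : ℕ → Tree → Set
IsT n t = labels t ↭ range n × Increasing t

rightmostLabel : Tree → Maybe ℕ
rightmostLabel (leaf m)     = m
rightmostLabel (node _ _ r) = rightmostLabel r

IsTStar : ℕ → Tree → Set
IsTStar n t = IsT n t × Σ ℕ (λ a → rightmostLabel t ≡ just a)

IsTStark : ℕ → ℕ → Tree → Set
IsTStark n k t = IsTStar n t × rightmostLabel t ≡ just k

-- Cut σ at its entry m of least absolute value, σ = A m B: the tree has root |m|, its right
-- subtree comes from A and its left subtree from B.  The rightmost path thus runs through ever
-- shorter prefixes of σ and ends at σ₁, which becomes a labelled leaf because σ₁ < 0 and
-- |σ₂| < |σ₁|; the rightmost label is |σ₁|.  Every subword met in this recursion starts either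
-- at σ₁ or right after an entry smaller than all of it, so its first entry is never a valley and
-- its second entry is positive.  Hence when m is the first entry of its subword, the root gets
-- an empty right leaf and the sign of m can be stored on the next entry.  Reading a node a with
-- subtrees l, r back as word(r) a word(l) (moving the sign back when r is empty) inverts this
-- on increasing trees; the valley condition is exactly what makes it land in VS^(D).

module Submission where

open import Defs
open import Data.Nat as ℕ using (ℕ; zero; suc; z≤n; s≤s; _+_; _≤_; _<_; _∸_)
import Data.Nat.Properties as ℕP
open import Data.Integer as ℤ using (ℤ; +_; -[1+_]; ∣_∣; -_; sign; _◃_)
import Data.Integer.Properties as ℤP
open import Data.List using (List; []; _∷_; _++_; map; length; upTo)
import Data.List.Properties as LP
open import Data.List.Relation.Unary.All as All using (All; []; _∷_)
import Data.List.Relation.Unary.All.Properties as AllP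
open import Data.List.Relation.Unary.Unique.Propositional using (Unique; []; _∷_)
import Data.List.Relation.Unary.Unique.Propositional.Properties as UniqueP
import Data.List.Relation.Unary.AllPairs as AllPairs
open import Data.List.Relation.Binary.Permutation.Propositional as Perm
  using (_↭_; ↭-refl; ↭-sym; ↭-trans; ↭⇒↭ₛ)
import Data.List.Relation.Binary.Permutation.Propositional.Properties as PermP
import Data.List.Relation.Binary.Permutation.Setoid.Properties as PermₛP
open import Data.Maybe using (just; nothing)
import Data.Maybe.Properties as Maybe
open import Data.Product as Product using (Σ; _×_; _,_; proj₁; proj₂)
open import Data.Sum using (inj₁; inj₂)
open import Data.Unit using (⊤; tt)
open import Data.Empty using (⊥; ⊥-elim)
open import Function using (_∘_)
open import Function.Bundles using (_⇔_; mk⇔; Equivalence)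
open import Relation.Nullary using (¬_; yes; no)
open import Relation.Binary.PropositionalEquality
  using (_≡_; _≢_; refl; sym; trans; cong; cong₂; subst; setoid; module ≡-Reasoning)

◃-sign-◃ : ∀ s {a} b → 1 ≤ a → sign (s ◃ a) ◃ b ≡ s ◃ b
◃-sign-◃ s b 1≤a = cong (_◃ b) (ℤP.sign-◃ s _ {{ℕ.>-nonZero 1≤a}})

length-++-∷ : ∀ {A : Set} (xs : List A) x ys → length (xs ++ x ∷ ys) ≡ suc (length xs + length ys)
length-++-∷ xs x ys = trans (LP.length-++ xs) (ℕP.+-suc (length xs) (length ys))

fuel-split : ∀ {m n f} → suc (m + n) ≤ suc f → m ≤ f × n ≤ f
fuel-split {m} (s≤s h) = ℕP.m+n≤o⇒m≤o m h , ℕP.m+n≤o⇒n≤o m h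

All-resp-abs : ∀ {P : ℕ → Set} {xs ys : List ℤ} → map ∣_∣ xs ≡ map ∣_∣ ys →
               All (P ∘ ∣_∣) xs → All (P ∘ ∣_∣) ys
All-resp-abs {P} e = AllP.map⁻ ∘ subst (All P) e ∘ AllP.map⁺

Unique-++⁻ : ∀ {A : Set} (xs : List A) {ys} → Unique (xs ++ ys) → Unique xs × Unique ys
Unique-++⁻ []       u       = [] , u
Unique-++⁻ (x ∷ xs) (h ∷ u) = Product.map₁ (AllP.++⁻ˡ xs h ∷_) (Unique-++⁻ xs u)

Split : Set
Split = List ℤ × ℤ × List ℤ

IsMinSplit : List ℤ → Split → Set
IsMinSplit σ (A , m , B) =
  A ++ m ∷ B ≡ σ × All (λ a → ∣ m ∣ < ∣ a ∣) A × All (λ b → ∣ m ∣ ≤ ∣ b ∣) B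

prependSplit : ℤ → Split → Split
prependSplit a (A , m , B) = a ∷ A , m , B

consSplit : ℤ → List ℤ → Split → Split
consSplit x xs s@(_ , m , _) with ∣ x ∣ ℕ.≤? ∣ m ∣
... | yes _ = [] , x , xs
... | no  _ = prependSplit x s

minSplit : ℤ → List ℤ → Split
minSplit x []       = [] , x , []
minSplit x (y ∷ ys) = consSplit x (y ∷ ys) (minSplit y ys)

minSplit-isMinSplit : ∀ x xs → IsMinSplit (x ∷ xs) (minSplit x xs)
minSplit-isMinSplit x []       = refl , [] , []
minSplit-isMinSplit x (y ∷ ys) with minSplit y ys | minSplit-isMinSplit y ys
... | A , m , B | e , m<A , m≤B with ∣ x ∣ ℕ.≤? ∣ m ∣
...   | yes x≤m = refl , [] , subst (All _) e
                    (AllP.++⁺ (All.map (λ m<a → ℕP.≤-trans x≤m (ℕP.<⇒≤ m<a)) m<A)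
                              (x≤m ∷ All.map (ℕP.≤-trans x≤m) m≤B))
...   | no  x≰m = cong (x ∷_) e , ℕP.≰⇒> x≰m ∷ m<A , m≤B

IsMinSplit-unique : ∀ {σ} s t → IsMinSplit σ s → IsMinSplit σ t → s ≡ t
IsMinSplit-unique ([] , m , B) ([] , _ , _) (refl , _) (refl , _) = refl
IsMinSplit-unique ([] , m , _) (a ∷ A , m′ , B′) (refl , _ , m≤) (refl , m′<a ∷ _ , _)
  with AllP.++⁻ʳ A m≤
... | m≤m′ ∷ _ = ⊥-elim (ℕP.<⇒≱ m′<a m≤m′)
IsMinSplit-unique (a ∷ A , m , B) ([] , m′ , _) (refl , m<a ∷ _ , _) (e , _ , m′≤)
  with LP.∷-injective e
... | refl , refl with AllP.++⁻ʳ A m′≤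
...   | m′≤m ∷ _ = ⊥-elim (ℕP.<⇒≱ m<a m′≤m)
IsMinSplit-unique (a ∷ A , m , B) (a′ ∷ A′ , m′ , B′) (refl , _ ∷ m<A , m≤B) (e , _ ∷ m′<A′ , m′≤B′)
  = cong₂ prependSplit (sym (LP.∷-injectiveˡ e))
      (IsMinSplit-unique (A , m , B) (A′ , m′ , B′)
        (refl , m<A , m≤B) (LP.∷-injectiveʳ e , m′<A′ , m′≤B′))

minSplit-unique : ∀ {x xs} s → IsMinSplit (x ∷ xs) s → minSplit x xs ≡ s
minSplit-unique s = IsMinSplit-unique _ s (minSplit-isMinSplit _ _)

leafTree : ℤ → Tree
leafTree (+ a)    = node a (leaf nothing) (leaf nothing)
leafTree -[1+ a ] = leaf (just (suc a))

mutual
  toTree : ℕ → List ℤ → Tree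
  toTree _       []       = leaf nothing
  toTree zero    (_ ∷ _)  = leaf nothing
  toTree (suc f) (x ∷ xs) = splitTree f (minSplit x xs)

  splitTree : ℕ → Split → Tree
  splitTree f ([] , m , [])     = leafTree m
  -- m is the first entry: its sign is handed on to b, which the valley condition keeps positive.
  splitTree f ([] , m , b ∷ bs) = node ∣ m ∣ (toTree f ((sign m ◃ ∣ b ∣) ∷ bs)) (leaf nothing)
  splitTree f (a ∷ A , m , B)   = node ∣ m ∣ (toTree f B) (toTree f (a ∷ A))

φ : List ℤ → Tree
φ σ = toTree (length σ) σ

graft : ℕ → List ℤ → List ℤ → List ℤ
graft a L        (y ∷ R) = y ∷ R ++ + a ∷ L
graft a []       []      = + a ∷ []
graft a (x ∷ xs) []      = (sign x ◃ a) ∷ + ∣ x ∣ ∷ xs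

toWord : Tree → List ℤ
toWord (leaf nothing)  = []
toWord (leaf (just a)) = - (+ a) ∷ []
toWord (node a l r)    = graft a (toWord l) (toWord r)

graft-abs : ∀ a L R → map ∣_∣ (graft a L R) ↭ map ∣_∣ L ++ a ∷ map ∣_∣ R
graft-abs a L (y ∷ R) = begin
  map ∣_∣ (y ∷ R ++ + a ∷ L)         ≡⟨ LP.map-++ ∣_∣ (y ∷ R) (+ a ∷ L) ⟩
  map ∣_∣ (y ∷ R) ++ a ∷ map ∣_∣ L   ↭⟨ PermP.++-comm (map ∣_∣ (y ∷ R)) (a ∷ map ∣_∣ L) ⟩
  a ∷ map ∣_∣ L ++ map ∣_∣ (y ∷ R)   ↭⟨ PermP.shift a (map ∣_∣ L) (map ∣_∣ (y ∷ R)) ⟨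
  map ∣_∣ L ++ a ∷ map ∣_∣ (y ∷ R)   ∎
  where open Perm.PermutationReasoning
graft-abs a []       [] = ↭-refl
graft-abs a (x ∷ xs) [] rewrite ℤP.abs-◃ (sign x) a = PermP.++-comm (a ∷ []) (map ∣_∣ (x ∷ xs))

toWord-abs : ∀ t → map ∣_∣ (toWord t) ↭ labels t
toWord-abs (leaf nothing)  = ↭-refl
toWord-abs (leaf (just a)) rewrite ℤP.∣-i∣≡∣i∣ (+ a) = ↭-refl
toWord-abs (node a l r)    =
  ↭-trans (graft-abs a (toWord l) (toWord r)) (PermP.++⁺ (toWord-abs l) (Perm.prep a (toWord-abs r)))

All-labels⇒All-toWord : ∀ {P : ℕ → Set} t → All P (labels t) → All (P ∘ ∣_∣) (toWord t)
All-labels⇒All-toWord t = AllP.map⁻ ∘ PermP.All-resp-↭ (↭-sym (toWord-abs t))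

All-toWord⇒All-labels : ∀ {P : ℕ → Set} t → All (P ∘ ∣_∣) (toWord t) → All P (labels t)
All-toWord⇒All-labels t = PermP.All-resp-↭ (toWord-abs t) ∘ AllP.map⁺

Above⇒All-labels : ∀ {a} t → Increasing t → Above a t → All (a <_) (labels t)
Above⇒All-labels (leaf nothing)  _ _   = []
Above⇒All-labels (leaf (just b)) _ a<b = a<b ∷ []
Above⇒All-labels (node b l r) (b<l , b<r , inc-l , inc-r) a<b =
  AllP.++⁺ (All.map (ℕP.<-trans a<b) (Above⇒All-labels l inc-l b<l))
           (a<b ∷ All.map (ℕP.<-trans a<b) (Above⇒All-labels r inc-r b<r))

All-labels⇒Above : ∀ {a} t → All (a <_) (labels t) → Above a t
All-labels⇒Above (leaf nothing)  _          = tt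
All-labels⇒Above (leaf (just b)) (a<b ∷ []) = a<b
All-labels⇒Above (node b l r)    h          with AllP.++⁻ʳ (labels l) h
... | a<b ∷ _ = a<b

Above⇒All-toWord : ∀ {a} t → Increasing t → Above a t → All (λ z → a < ∣ z ∣) (toWord t)
Above⇒All-toWord t inc a<t = All-labels⇒All-toWord t (Above⇒All-labels t inc a<t)

Above-toWord : ∀ {a σ} t → toWord t ≡ σ → All (λ z → a < ∣ z ∣) σ → Above a t
Above-toWord t refl = All-labels⇒Above t ∘ All-toWord⇒All-labels t

-- p and q are the absolute values of the two entries preceding r.
ValleySignedFrom : ℕ → ℕ → List ℤ → Set
ValleySignedFrom p q []      = ⊤
ValleySignedFrom p q (z ∷ r) = (z ℤ.< + 0 → q < p × q < ∣ z ∣) × ValleySignedFrom q ∣ z ∣ r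

ValleySigned : List ℤ → Set
ValleySigned []      = ⊤
ValleySigned (x ∷ r) = ValleySignedFrom 0 ∣ x ∣ r

ValleySignedFrom-rebase : ∀ {p q} p′ r → p ≤ q → ValleySignedFrom p q r → ValleySignedFrom p′ q r
ValleySignedFrom-rebase p′ []      _   _           = tt
ValleySignedFrom-rebase p′ (z ∷ r) p≤q (h , rest) = (λ z<0 → ⊥-elim (ℕP.≤⇒≯ p≤q (proj₁ (h z<0)))) , rest

ValleySignedFrom-++⁻ˡ : ∀ {p q} X {Y} → ValleySignedFrom p q (X ++ Y) → ValleySignedFrom p q X
ValleySignedFrom-++⁻ˡ []      _          = tt
ValleySignedFrom-++⁻ˡ (z ∷ X) (h , rest) = h , ValleySignedFrom-++⁻ˡ X rest

ValleySignedFrom-suffix : ∀ {p q} X z Y → All (λ y → ∣ z ∣ ≤ ∣ y ∣) Y →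
                          ValleySignedFrom p q (X ++ z ∷ Y) → ValleySigned Y
ValleySignedFrom-suffix (x ∷ X) z Y       z≤Y       (_ , rest)     = ValleySignedFrom-suffix X z Y z≤Y rest
ValleySignedFrom-suffix []      z []      _         _              = tt
ValleySignedFrom-suffix []      z (y ∷ Y) (z≤y ∷ _) (_ , _ , rest) = ValleySignedFrom-rebase 0 Y z≤y rest

-- A negative z would need a predecessor smaller than |z|.
ValleySignedFrom-leftMin : ∀ {p q} X z Y → ∣ z ∣ < q → All (λ x → ∣ z ∣ < ∣ x ∣) X →
                           ValleySignedFrom p q (X ++ z ∷ Y) → ¬ z ℤ.< + 0
ValleySignedFrom-leftMin []      z Y z<q _           (h , _)    z<0 = ℕP.<-asym z<q (proj₂ (h z<0))
ValleySignedFrom-leftMin (x ∷ X) z Y _   (z<x ∷ z<X) (_ , rest) =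
  ValleySignedFrom-leftMin X z Y z<x z<X rest

ValleySignedFrom-graft : ∀ {p q a} R L → ValleySignedFrom p q R → a < q → All (λ z → a < ∣ z ∣) R →
                         ValleySigned L → All (λ z → a < ∣ z ∣) L → ValleySignedFrom p q (R ++ + a ∷ L)
ValleySignedFrom-graft (y ∷ R) L (h , rest) a<q (a<y ∷ a<R) vL a<L =
  h , ValleySignedFrom-graft R L rest a<y a<R vL a<L
ValleySignedFrom-graft []      []      _ _   _ _  _ = (λ { (ℤ.+<+ ()) }) , tt
ValleySignedFrom-graft {a = a} [] (z ∷ L) _ a<q _ vL (a<z ∷ _) =
  (λ { (ℤ.+<+ ()) }) , (λ _ → a<q , a<z) , ValleySignedFrom-rebase a L z≤n vL

toWord-valleySigned : ∀ t → Increasing t → ValleySigned (toWord t)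
toWord-valleySigned (leaf nothing)  _ = tt
toWord-valleySigned (leaf (just a)) _ = tt
toWord-valleySigned (node a l r) (a<l , a<r , inc-l , inc-r) = graft-valleySigned (toWord l) (toWord r)
  (toWord-valleySigned l inc-l) (toWord-valleySigned r inc-r)
  (Above⇒All-toWord l inc-l a<l) (Above⇒All-toWord r inc-r a<r)
  where
  graft-valleySigned : ∀ L R → ValleySigned L → ValleySigned R →
    All (λ z → a < ∣ z ∣) L → All (λ z → a < ∣ z ∣) R → ValleySigned (graft a L R)
  graft-valleySigned L        (y ∷ R) vL vR a<L (a<y ∷ a<R) =
    ValleySignedFrom-graft R L vR a<y a<R vL a<L
  graft-valleySigned []       []      _  _  _   _           = tt
  graft-valleySigned (x ∷ xs) []      vL _  _   _           =
    (λ { (ℤ.+<+ ()) }) , ValleySignedFrom-rebase _ xs z≤n vL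

record Admissible (σ : List ℤ) : Set where
  constructor admissible
  field
    valleySigned : ValleySigned σ
    distinct     : Unique (map ∣_∣ σ)
    nonzero      : All (λ z → 1 ≤ ∣ z ∣) σ

IsMinSplit-strict : ∀ {σ A m B} → IsMinSplit σ (A , m , B) → Unique (map ∣_∣ σ) →
                    All (λ b → ∣ m ∣ < ∣ b ∣) B
IsMinSplit-strict {A = A} {m} {B} (refl , _ , m≤B) u =
  All.zipWith (λ (m≤b , m≢b) → ℕP.≤∧≢⇒< m≤b m≢b) (m≤B , AllP.map⁻ m≢B)
  where
  m≢B : All (∣ m ∣ ≢_) (map ∣_∣ B)
  m≢B = AllPairs.head (proj₂ (Unique-++⁻ (map ∣_∣ A) (subst Unique (LP.map-++ ∣_∣ A (m ∷ B)) u)))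

Admissible-transferSign : ∀ {m b bs} → ∣ m ∣ ≤ ∣ b ∣ → Admissible (m ∷ b ∷ bs) →
                          Admissible ((sign m ◃ ∣ b ∣) ∷ bs) × + 0 ℤ.≤ b
Admissible-transferSign {m} {b} {bs} m≤b (admissible (b-valley , vs) (_ ∷ u) (_ ∷ nz)) =
  admissible (subst (λ c → ValleySignedFrom 0 c bs) (sym ∣b′∣≡∣b∣) (ValleySignedFrom-rebase 0 bs m≤b vs))
             (subst Unique (sym abs-eq) u)
             (All-resp-abs {1 ≤_} (sym abs-eq) nz) ,
  ℤP.≮⇒≥ (λ b<0 → ℕP.n≮0 (proj₁ (b-valley b<0)))
  where
  ∣b′∣≡∣b∣ : ∣ sign m ◃ ∣ b ∣ ∣ ≡ ∣ b ∣
  ∣b′∣≡∣b∣ = ℤP.abs-◃ (sign m) ∣ b ∣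
  abs-eq : map ∣_∣ ((sign m ◃ ∣ b ∣) ∷ bs) ≡ map ∣_∣ (b ∷ bs)
  abs-eq = cong (_∷ map ∣_∣ bs) ∣b′∣≡∣b∣

Admissible-split : ∀ {a A m B} → IsMinSplit (a ∷ A ++ m ∷ B) (a ∷ A , m , B) →
                   Admissible (a ∷ A ++ m ∷ B) → Admissible (a ∷ A) × Admissible B × + 0 ℤ.≤ m
Admissible-split {a} {A} {m} {B} (_ , m<a ∷ m<A , m≤B) (admissible vs u nz) =
  admissible (ValleySignedFrom-++⁻ˡ A vs) (proj₁ uniqueParts) (AllP.++⁻ˡ (a ∷ A) nz) ,
  admissible (ValleySignedFrom-suffix A m B m≤B vs) (AllPairs.tail (proj₂ uniqueParts))
             (All.tail (AllP.++⁻ʳ (a ∷ A) nz)) ,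
  ℤP.≮⇒≥ (ValleySignedFrom-leftMin A m B m<a m<A vs)
  where
  uniqueParts : Unique (map ∣_∣ (a ∷ A)) × Unique (∣ m ∣ ∷ map ∣_∣ B)
  uniqueParts = Unique-++⁻ (map ∣_∣ (a ∷ A)) (subst Unique (LP.map-++ ∣_∣ (a ∷ A) (m ∷ B)) u)

length-graft : ∀ a L R → length (graft a L R) ≡ suc (length L + length R)
length-graft a L (y ∷ R) =
  trans (length-++-∷ (y ∷ R) (+ a) L) (cong suc (ℕP.+-comm (length (y ∷ R)) (length L)))
length-graft a []       [] = refl
length-graft a (x ∷ xs) [] = cong suc (sym (ℕP.+-identityʳ (suc (length xs))))

toTree-graft : ∀ f a L R → 1 ≤ a → All (λ z → a < ∣ z ∣) L → All (λ z → a < ∣ z ∣) R →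
               toTree (suc f) (graft a L R) ≡ node a (toTree f L) (toTree f R)
toTree-graft f a L (y ∷ R) _ a<L (a<y ∷ a<R) =
  cong (splitTree f) (minSplit-unique (y ∷ R , + a , L) (refl , a<y ∷ a<R , All.map ℕP.<⇒≤ a<L))
toTree-graft f a [] [] _ _ _ = refl
toTree-graft f a (x ∷ xs) [] 1≤a (a<x ∷ a<xs) _ = begin
  splitTree f (minSplit (sign x ◃ a) (+ ∣ x ∣ ∷ xs))
    ≡⟨ cong (splitTree f) (minSplit-unique ([] , sign x ◃ a , + ∣ x ∣ ∷ xs) (refl , [] , a≤x∷xs)) ⟩
  node ∣ sign x ◃ a ∣ (toTree f ((sign (sign x ◃ a) ◃ ∣ x ∣) ∷ xs)) (leaf nothing)
    ≡⟨ cong₂ (λ b y → node b (toTree f (y ∷ xs)) (leaf nothing))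
             (ℤP.abs-◃ (sign x) a) (trans (◃-sign-◃ (sign x) ∣ x ∣ 1≤a) (ℤP.◃-inverse x)) ⟩
  node a (toTree f (x ∷ xs)) (leaf nothing) ∎
  where
  open ≡-Reasoning
  a≤x∷xs : All (λ b → ∣ sign x ◃ a ∣ ≤ ∣ b ∣) (+ ∣ x ∣ ∷ xs)
  a≤x∷xs = subst (λ c → All (λ b → c ≤ ∣ b ∣) (+ ∣ x ∣ ∷ xs)) (sym (ℤP.abs-◃ (sign x) a))
                 (All.map ℕP.<⇒≤ (a<x ∷ a<xs))

toTree-toWord : ∀ f t → Increasing t → All (1 ≤_) (labels t) → length (toWord t) ≤ f →
                toTree f (toWord t) ≡ t
toTree-toWord f       (leaf nothing)        _ _ _ = refl
toTree-toWord zero    (leaf (just _))       _ _ ()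
toTree-toWord (suc f) (leaf (just zero))    _ (() ∷ []) _
toTree-toWord (suc f) (leaf (just (suc k))) _ _ _ = refl
toTree-toWord zero    (node a l r) _ _ len with subst (_≤ 0) (length-graft a (toWord l) (toWord r)) len
... | ()
toTree-toWord (suc f) (node a l r) (a<l , a<r , inc-l , inc-r) pos len = begin
  toTree (suc f) (graft a (toWord l) (toWord r))
    ≡⟨ toTree-graft f a (toWord l) (toWord r) 1≤a
                    (Above⇒All-toWord l inc-l a<l) (Above⇒All-toWord r inc-r a<r) ⟩
  node a (toTree f (toWord l)) (toTree f (toWord r))
    ≡⟨ cong₂ (node a) (toTree-toWord f l inc-l pos-l (proj₁ fuel))
                      (toTree-toWord f r inc-r pos-r (proj₂ fuel)) ⟩
  node a l r ∎
  where
  open ≡-Reasoning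
  fuel : length (toWord l) ≤ f × length (toWord r) ≤ f
  fuel = fuel-split (subst (_≤ suc f) (length-graft a (toWord l) (toWord r)) len)
  pos-l : All (1 ≤_) (labels l)
  pos-l = AllP.++⁻ˡ (labels l) pos
  pos-r : All (1 ≤_) (labels r)
  pos-r = All.tail (AllP.++⁻ʳ (labels l) pos)
  1≤a : 1 ≤ a
  1≤a = All.head (AllP.++⁻ʳ (labels l) pos)

graft-transferSign : ∀ m {b} bs → 1 ≤ ∣ b ∣ → + 0 ℤ.≤ b →
                     graft ∣ m ∣ ((sign m ◃ ∣ b ∣) ∷ bs) [] ≡ m ∷ b ∷ bs
graft-transferSign m bs 1≤b b≥0 = cong₂ (λ x y → x ∷ y ∷ bs)
  (trans (◃-sign-◃ (sign m) ∣ m ∣ 1≤b) (ℤP.◃-inverse m))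
  (trans (cong +_ (ℤP.abs-◃ (sign m) _)) (ℤP.0≤i⇒+∣i∣≡i b≥0))

toWord-leafTree : ∀ m → toWord (leafTree m) ≡ m ∷ [] × Increasing (leafTree m)
toWord-leafTree (+ a)    = refl , tt , tt , tt , tt
toWord-leafTree -[1+ a ] = refl , tt

mutual
  toWord-toTree : ∀ f σ → length σ ≤ f → Admissible σ → toWord (toTree f σ) ≡ σ × Increasing (toTree f σ)
  toWord-toTree f       []       _   _   = refl , tt
  toWord-toTree zero    (x ∷ xs) ()  _
  toWord-toTree (suc f) (x ∷ xs) len adm =
    toWord-splitTree f (minSplit x xs) (minSplit-isMinSplit x xs) len adm

  toWord-splitTree : ∀ f {σ} s → IsMinSplit σ s → length σ ≤ suc f → Admissible σ →
                     toWord (splitTree f s) ≡ σ × Increasing (splitTree f s)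
  toWord-splitTree f ([] , m , []) (refl , _) _ _ = toWord-leafTree m
  toWord-splitTree f ([] , m , b ∷ bs) split@(refl , _ , m≤b ∷ _) (s≤s len) adm
    with Admissible-transferSign m≤b adm
  ... | adm′ , b≥0 with toWord-toTree f ((sign m ◃ ∣ b ∣) ∷ bs) len adm′
  ...   | e , inc =
    trans (cong (λ w → graft ∣ m ∣ w []) e)
          (graft-transferSign m bs (All.head (All.tail (Admissible.nonzero adm))) b≥0) ,
    Above-toWord _ e m<b′∷bs , tt , inc , tt
    where
    m<b′∷bs : All (λ z → ∣ m ∣ < ∣ z ∣) ((sign m ◃ ∣ b ∣) ∷ bs)
    m<b′∷bs = All-resp-abs {∣ m ∣ <_} (cong (_∷ map ∣_∣ bs) (sym (ℤP.abs-◃ (sign m) ∣ b ∣)))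
                           (IsMinSplit-strict split (Admissible.distinct adm))
  toWord-splitTree f (a ∷ A , m , B) split@(refl , m<A , _) len adm
    with Admissible-split split adm | fuel-split (subst (_≤ suc f) (length-++-∷ (a ∷ A) m B) len)
  ... | adm-A , adm-B , m≥0 | fuel-A , fuel-B
    with toWord-toTree f (a ∷ A) fuel-A adm-A | toWord-toTree f B fuel-B adm-B
  ...   | e-A , inc-A | e-B , inc-B =
    word , Above-toWord _ e-B (IsMinSplit-strict split (Admissible.distinct adm)) ,
           Above-toWord _ e-A m<A , inc-B , inc-A
    where
    open ≡-Reasoning
    word : graft ∣ m ∣ (toWord (toTree f B)) (toWord (toTree f (a ∷ A))) ≡ a ∷ A ++ m ∷ B
    word = begin
      graft ∣ m ∣ (toWord (toTree f B)) (toWord (toTree f (a ∷ A)))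
        ≡⟨ cong₂ (graft ∣ m ∣) e-B e-A ⟩
      a ∷ A ++ + ∣ m ∣ ∷ B
        ≡⟨ cong (λ z → a ∷ A ++ z ∷ B) (ℤP.0≤i⇒+∣i∣≡i m≥0) ⟩
      a ∷ A ++ m ∷ B ∎

StartsBelow : ℕ → List ℤ → Set
StartsBelow a []      = ⊤
StartsBelow a (y ∷ _) = ∣ y ∣ < a

StartsBelow-++⁻ˡ : ∀ {a} xs {ys} → StartsBelow a (xs ++ ys) → StartsBelow a xs
StartsBelow-++⁻ˡ []      _ = tt
StartsBelow-++⁻ˡ (_ ∷ _) h = h

mutual
  toTree-rightmost : ∀ f x xs → length (x ∷ xs) ≤ f → x ℤ.< + 0 → StartsBelow ∣ x ∣ xs →
                     rightmostLabel (toTree f (x ∷ xs)) ≡ just ∣ x ∣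
  toTree-rightmost zero    x xs ()
  toTree-rightmost (suc f) x xs len =
    splitTree-rightmost f (minSplit x xs) (minSplit-isMinSplit x xs) len

  splitTree-rightmost : ∀ f {x xs} s → IsMinSplit (x ∷ xs) s → length (x ∷ xs) ≤ suc f →
                        x ℤ.< + 0 → StartsBelow ∣ x ∣ xs → rightmostLabel (splitTree f s) ≡ just ∣ x ∣
  splitTree-rightmost f ([] , -[1+ _ ] , []) (refl , _) _ _ _ = refl
  splitTree-rightmost f ([] , + _ , [])      (refl , _) _ (ℤ.+<+ ())
  splitTree-rightmost f ([] , _ , _ ∷ _) (refl , _ , x≤b ∷ _) _ _ b<x = ⊥-elim (ℕP.<⇒≱ b<x x≤b)
  splitTree-rightmost f (a ∷ A , m , B) (refl , _) len x<0 below =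
    toTree-rightmost f a A (proj₁ (fuel-split (subst (_≤ suc f) (length-++-∷ (a ∷ A) m B) len)))
                     x<0 (StartsBelow-++⁻ˡ A below)

Above-rightmost : ∀ {a k} t → Above a t → Increasing t → rightmostLabel t ≡ just k → a < k
Above-rightmost (leaf (just _)) a<k _ refl = a<k
Above-rightmost (node b l r) a<b (_ , b<r , _ , inc-r) rm =
  ℕP.<-trans a<b (Above-rightmost r b<r inc-r rm)

All-rightmost : ∀ {P : ℕ → Set} {k} t → All P (labels t) → rightmostLabel t ≡ just k → P k
All-rightmost (leaf (just _)) (pk ∷ []) refl = pk
All-rightmost (node _ l r)    h         rm   = All-rightmost r (All.tail (AllP.++⁻ʳ (labels l) h)) rm

toWord-rightmost : ∀ {k} t → Increasing t → rightmostLabel t ≡ just k →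
                   Σ (List ℤ) λ rest → toWord t ≡ - (+ k) ∷ rest × StartsBelow k rest
toWord-rightmost (leaf (just _)) _ refl = [] , refl , tt
toWord-rightmost {k} (node a l r) (_ , a<r , _ , inc-r) rm with toWord-rightmost r inc-r rm
... | rest , e , below rewrite e = rest ++ + a ∷ toWord l , refl , startsBelow rest below
  where
  startsBelow : ∀ xs → StartsBelow k xs → StartsBelow k (xs ++ + a ∷ toWord l)
  startsBelow []      _ = Above-rightmost r a<r inc-r rm
  startsBelow (_ ∷ _) h = h

ValleyAt : List ℕ → ℕ → Set
ValleyAt w i = entry 0 w i < entry 0 w (i ∸ 1) × entry 0 w i < entry 0 w (suc i)

NegativesAtValleys : ℕ → ℕ → List ℤ → Set
NegativesAtValleys p q r =
  ∀ j → entry (+ 0) r (suc j) ℤ.< + 0 → ValleyAt (p ∷ q ∷ map ∣_∣ r) (suc (suc j))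

ValleySignedFrom⇔NegativesAtValleys : ∀ p q r → ValleySignedFrom p q r ⇔ NegativesAtValleys p q r
ValleySignedFrom⇔NegativesAtValleys p q r = mk⇔ (to p q r) (from p q r)
  where
  to : ∀ p q r → ValleySignedFrom p q r → NegativesAtValleys p q r
  to p q []      _          _       (ℤ.+<+ ())
  to p q (z ∷ r) (h , _)    zero    z<0 = h z<0
  to p q (z ∷ r) (_ , rest) (suc j) neg = to q ∣ z ∣ r rest j neg
  from : ∀ p q r → NegativesAtValleys p q r → ValleySignedFrom p q r
  from p q []      _ = tt
  from p q (z ∷ r) h = h zero , from q ∣ z ∣ r (h ∘ suc)

ValleysIndexed : ℕ → List ℤ → Set
ValleysIndexed n σ = ∀ i → 3 ≤ i → i ≤ n → σ[ σ ] i ℤ.< + 0 → IsValley n (map ∣_∣ σ) (i ∸ 1)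

negative-entry⇒≤length : ∀ (r : List ℤ) j → entry (+ 0) r (suc j) ℤ.< + 0 → suc j ≤ length r
negative-entry⇒≤length []      j       (ℤ.+<+ ())
negative-entry⇒≤length (_ ∷ r) zero    _   = s≤s z≤n
negative-entry⇒≤length (_ ∷ r) (suc j) neg = s≤s (negative-entry⇒≤length r j neg)

ValleysIndexed⇔NegativesAtValleys : ∀ x y r →
  ValleysIndexed (length (x ∷ y ∷ r)) (x ∷ y ∷ r) ⇔ NegativesAtValleys ∣ x ∣ ∣ y ∣ r
ValleysIndexed⇔NegativesAtValleys x y r = mk⇔ to from
  where
  to : ValleysIndexed (length (x ∷ y ∷ r)) (x ∷ y ∷ r) → NegativesAtValleys ∣ x ∣ ∣ y ∣ r
  to valleys j neg
    with valleys (3 + j) (s≤s (s≤s (s≤s z≤n))) (s≤s (s≤s (negative-entry⇒≤length r j neg))) neg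
  ... | inj₁ (() , _)
  ... | inj₂ (_ , _ , valley) = valley
  from : NegativesAtValleys ∣ x ∣ ∣ y ∣ r → ValleysIndexed (length (x ∷ y ∷ r)) (x ∷ y ∷ r)
  from valleys (suc zero)          (s≤s ())
  from valleys (suc (suc zero))    (s≤s (s≤s ()))
  from valleys (suc (suc (suc j))) _ (s≤s i≤n) neg = inj₂ (s≤s (s≤s z≤n) , i≤n , valleys j neg)

NegativeDescent : List ℤ → Set
NegativeDescent []       = ⊥
NegativeDescent (x ∷ xs) = x ℤ.< + 0 × StartsBelow ∣ x ∣ xs

VSDˢ : ℕ → List ℤ → Set
VSDˢ n σ = SignedPerm n σ × NegativeDescent σ × ValleySigned σ

positive-below : ∀ {y a} → + 0 ℤ.< y → y ℤ.< + a → ∣ y ∣ < a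
positive-below (ℤ.+<+ _) (ℤ.+<+ y<a) = y<a

nonneg-below : ∀ {y a} → ¬ y ℤ.< + 0 → 1 ≤ ∣ y ∣ → ∣ y ∣ < a → + 0 ℤ.< y × y ℤ.< + a
nonneg-below {+ _}      _   1≤y y<a = ℤ.+<+ 1≤y , ℤ.+<+ y<a
nonneg-below { -[1+ _ ]} y≮0 _   _   = ⊥-elim (y≮0 ℤ.-<+)

range-nonzero : ∀ n → All (1 ≤_) (range n)
range-nonzero n = AllP.map⁺ (All.universal (λ _ → s≤s z≤n) (upTo n))

range-unique : ∀ n → Unique (range n)
range-unique n = UniqueP.map⁺ ℕP.suc-injective (UniqueP.upTo⁺ n)

↭-range⇒SignedPerm : ∀ {n σ} → map ∣_∣ σ ↭ range n → SignedPerm n σ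
↭-range⇒SignedPerm {n} {σ} p = length-σ , p
  where
  open ≡-Reasoning
  length-σ : length σ ≡ n
  length-σ = begin
    length σ             ≡⟨ LP.length-map ∣_∣ σ ⟨
    length (map ∣_∣ σ)   ≡⟨ PermP.↭-length p ⟩
    length (range n)     ≡⟨ LP.length-map suc (upTo n) ⟩
    length (upTo n)      ≡⟨ LP.length-upTo n ⟩
    n                    ∎

SignedPerm⇒nonzero : ∀ {n σ} → SignedPerm n σ → All (λ z → 1 ≤ ∣ z ∣) σ
SignedPerm⇒nonzero {n} (_ , p) = AllP.map⁻ (PermP.All-resp-↭ (↭-sym p) (range-nonzero n))

VSDˢ⇒Admissible : ∀ {n σ} → VSDˢ n σ → Admissible σ
VSDˢ⇒Admissible {n} (perm@(_ , p) , _ , vs) = admissible vs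
  (PermₛP.Unique-resp-↭ (setoid ℕ) (↭⇒↭ₛ (↭-sym p)) (range-unique n))
  (SignedPerm⇒nonzero perm)

VSD⇔VSDˢ : ∀ {n} σ → VSD n σ ⇔ VSDˢ n σ
VSD⇔VSDˢ σ = mk⇔ (to σ) (from σ)
  where
  to : ∀ {n} σ → VSD n σ → VSDˢ n σ
  to []          (_ , ℤ.+<+ () , _)
  to (x ∷ [])    (perm , x<0 , _) = perm , (x<0 , tt) , tt
  to (x ∷ y ∷ r) (perm@(refl , _) , x<0 , second , valleys) with second (s≤s (s≤s z≤n))
  ... | 0<y , y<x = perm , (x<0 , positive-below 0<y y<x) ,
    (λ y<0 → ⊥-elim (ℤP.<-asym 0<y y<0)) ,
    Equivalence.from (ValleySignedFrom⇔NegativesAtValleys ∣ x ∣ ∣ y ∣ r)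
      (Equivalence.to (ValleysIndexed⇔NegativesAtValleys x y r) valleys)
  from : ∀ {n} σ → VSDˢ n σ → VSD n σ
  from (x ∷ []) (perm@(refl , _) , (x<0 , _) , _) =
    perm , x<0 , (λ { (s≤s ()) }) , λ { _ (s≤s (s≤s (s≤s _))) (s≤s ()) _ }
  from (x ∷ y ∷ r) (perm@(refl , _) , (x<0 , y<x) , (y-valley , vs)) =
    perm , x<0 ,
    (λ _ → nonneg-below (λ y<0 → ℕP.n≮0 (proj₁ (y-valley y<0)))
                        (All.head (All.tail (SignedPerm⇒nonzero {σ = x ∷ y ∷ r} perm))) y<x) ,
    Equivalence.from (ValleysIndexed⇔NegativesAtValleys x y r)
      (Equivalence.to (ValleySignedFrom⇔NegativesAtValleys ∣ x ∣ ∣ y ∣ r) vs)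

φ-inverse : ∀ {n σ} → VSDˢ n σ → toWord (φ σ) ≡ σ × Increasing (φ σ)
φ-inverse {σ = σ} v = toWord-toTree (length σ) σ ℕP.≤-refl (VSDˢ⇒Admissible v)

φ-rightmost : ∀ {n} σ → VSDˢ n σ → rightmostLabel (φ σ) ≡ just ∣ σ[ σ ] 1 ∣
φ-rightmost (x ∷ xs) (_ , (x<0 , below) , _) =
  toTree-rightmost (length (x ∷ xs)) x xs ℕP.≤-refl x<0 below

φ-injective : ∀ {n σ τ} → VSDˢ n σ → VSDˢ n τ → φ σ ≡ φ τ → σ ≡ τ
φ-injective {σ = σ} {τ} vσ vτ e = begin
  σ              ≡⟨ proj₁ (φ-inverse vσ) ⟨
  toWord (φ σ)   ≡⟨ cong toWord e ⟩
  toWord (φ τ)   ≡⟨ proj₁ (φ-inverse vτ) ⟩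
  τ              ∎
  where open ≡-Reasoning

φ-IsTStar : ∀ {n} σ → VSDˢ n σ → IsTStar n (φ σ)
φ-IsTStar {n} σ v@((_ , p) , _) =
  (↭-trans (↭-sym (toWord-abs (φ σ)))
           (subst (λ w → map ∣_∣ w ↭ range n) (sym (proj₁ (φ-inverse v))) p) ,
   proj₂ (φ-inverse v)) ,
  ∣ σ[ σ ] 1 ∣ , φ-rightmost σ v

toWord-VSDˢ : ∀ {n} t → IsTStar n t → VSDˢ n (toWord t)
toWord-VSDˢ {n} t ((labels↭ , inc) , k , rm) =
  ↭-range⇒SignedPerm (↭-trans (toWord-abs t) labels↭) , descent , toWord-valleySigned t inc
  where
  descent : NegativeDescent (toWord t)
  descent with toWord-rightmost t inc rm
             | All-rightmost t (PermP.All-resp-↭ (↭-sym labels↭) (range-nonzero n)) rm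
  ... | rest , e , below | s≤s _ rewrite e =
    ℤ.-<+ , subst (λ c → StartsBelow c rest) (sym (ℤP.∣-i∣≡∣i∣ (+ k))) below

φ-toWord : ∀ {n} t → IsTStar n t → φ (toWord t) ≡ t
φ-toWord {n} t ((labels↭ , inc) , _) =
  toTree-toWord (length (toWord t)) t inc
    (PermP.All-resp-↭ (↭-sym labels↭) (range-nonzero n)) ℕP.≤-refl

φ-restricts : ∀ {n k} σ → VSDˢ n σ → VSDk n k σ ⇔ IsTStark n k (φ σ)
φ-restricts {k = k} σ@(x ∷ _) v@(_ , (x<0 , _) , _) = mk⇔
  (λ (_ , x≡-k) → φ-IsTStar σ v ,
     trans (φ-rightmost σ v) (cong just (trans (cong ∣_∣ x≡-k) (ℤP.∣-i∣≡∣i∣ (+ k)))))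
  (λ (_ , rm) → Equivalence.from (VSD⇔VSDˢ σ) v ,
     trans (sym (−∣x∣≡x x<0))
           (cong (-_ ∘ +_) (Maybe.just-injective (trans (sym (φ-rightmost σ v)) rm))))
  where
  −∣x∣≡x : ∀ {x} → x ℤ.< + 0 → - (+ ∣ x ∣) ≡ x
  −∣x∣≡x ℤ.-<+ = refl

theorem6p3 : (n : ℕ) → 1 ≤ n →
    Σ (List ℤ → Tree) λ φ →
        (∀ σ → VSD n σ → IsTStar n (φ σ))
      × (∀ σ τ → VSD n σ → VSD n τ → φ σ ≡ φ τ → σ ≡ τ)
      × (∀ t → IsTStar n t → Σ (List ℤ) λ σ → VSD n σ × φ σ ≡ t)
      × (∀ k → 1 ≤ k → k ≤ n → ∀ σ → VSD n σ → (VSDk n k σ ⇔ IsTStark n k (φ σ)))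
theorem6p3 n _ =
  φ ,
  (λ σ v → φ-IsTStar σ (structural v)) ,
  (λ σ τ vσ vτ → φ-injective (structural vσ) (structural vτ)) ,
  (λ t t∈T* → toWord t , Equivalence.from (VSD⇔VSDˢ (toWord t)) (toWord-VSDˢ t t∈T*) , φ-toWord t t∈T*) ,
  (λ k _ _ σ v → φ-restricts σ (structural v))
  where
  structural : ∀ {σ} → VSD n σ → VSDˢ n σ
  structural {σ} = Equivalence.to (VSD⇔VSDˢ σ)
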